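{- For integers $n\ge0$, $m$, let $B^{H}(n,m)$ be the number of vertically constrained $S_{DW}$ paths from $(0,0)$ to $(n,m)$ (no height restriction, first step arbitrary). Then $B^{H}(0,m)=1$ if $m\in\{ -1,0,1\}$ and $0$ otherwise, and for $n\ge1$, $m\in\mathbb{Z}$, $$B^{H}(n,m)=B^{H}(n-1,m+2)+B^{H}(n-1,m+1)+2B^{H}(n-1,m)+B^{H}(n-1,m-1)+B^{H}(n-1,m-2).$$
   Context: A lattice path is a finite sequence of steps (vectors in $\mathbb{Z}^2$) starting at $(0,0)$; its vertices are the partial sums, and it terminates at the last vertex (the empty path terminates at $(0,0)$). Let $S_D=\{(1,1),(1,-1)\}$ and $S_{DW}=S_D\cup\{(0,1),(0,-1)\}$; $(0,\pm1)$ are vertical steps. A vertically constrained $S_{DW}$ path is a lattice path with steps in $S_{DW}$ in which no two consecutive steps are both vertical. -}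

module Defs where

open import Data.List using (List; []; _∷_; foldl)
open import Data.Integer using (ℤ; +_; -_; _+_; 0ℤ; 1ℤ)
open import Data.Product using (_×_; _,_)
open import Data.Unit using (⊤)
open import Data.Empty using (⊥)
open import Relation.Binary.PropositionalEquality using (_≡_)

data Step : Set where
  NE SE : Step
  N  S  : Step

vector : Step → ℤ × ℤ
vector NE = (1ℤ , 1ℤ)
vector SE = (1ℤ , - 1ℤ)
vector N  = (0ℤ , 1ℤ)
vector S  = (0ℤ , - 1ℤ)

isVertical : Step → Set
isVertical NE = ⊥
isVertical SE = ⊥
isVertical N  = ⊤
isVertical S  = ⊤

Path : Set
Path = List Step

endpoint : Path → ℤ × ℤ
endpoint [] = (0ℤ , 0ℤ)
endpoint (s ∷ p) with vector s | endpoint p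
... | (a , b) | (c , d) = (a + c , b + d)

VerticallyConstrained : Path → Set
VerticallyConstrained [] = ⊤
VerticallyConstrained (s ∷ []) = ⊤
VerticallyConstrained (s ∷ t ∷ p) =
  (isVertical s → isVertical t → ⊥) × VerticallyConstrained (t ∷ p)

-- A walk reaching x = n + 1 starts with a block made of one diagonal step, possibly preceded
-- by a single vertical step; after the block the rest is again an arbitrary vertically
-- constrained walk, now to x = n.  The six blocks NE, SE, N·NE, N·SE, S·NE, S·SE change the
-- height by 1, -1, 2, 0, 0, -2, which is the recurrence.  A walk to x = 0 has no diagonal
-- step, so it is [], [N] or [S].
module Submission where

open import Defs
open import Algebra.Bundles using (AbelianGroup)
open import Axiom.UniquenessOfIdentityProofs.WithK using (uip)
open import Data.Empty using (⊥-elim)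
open import Data.Fin using (Fin)
open import Data.Fin.Properties using (+↔⊎)
open import Data.Integer using (ℤ; +_; -[1+_]; _+_; _-_; -_; 0ℤ; 1ℤ)
open import Data.Integer.Properties using (+-0-abelianGroup; +-comm; +-assoc; +-injective)
open import Data.List using ([]; _∷_)
open import Data.Nat using (ℕ; zero; suc; _*_)
import Data.Nat as N
open import Data.Nat.Tactic.RingSolver using (solve-∀)
open import Data.Product using (Σ; _×_; _,_; proj₁; proj₂)
open import Data.Sum using (_⊎_; inj₁; inj₂)
open import Data.Sum.Function.Propositional using (_⊎-↔_)
open import Data.Unit using (⊤; tt)
open import Function.Base using (_∘_)
open import Function.Bundles using (_↔_; mk↔ₛ′)
open import Function.Properties.Inverse using (↔-trans)
open import Relation.Nullary using (¬_; Irrelevant)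
open import Relation.Binary.PropositionalEquality
  using (_≡_; refl; sym; trans; cong; cong₂; module ≡-Reasoning)

open import Algebra.Properties.Group (AbelianGroup.group +-0-abelianGroup)
  using (y≈x\\z; \\-leftDividesˡ; \\-leftDividesʳ)

Fin1↔-contractible : ∀ {A : Set} (c : A) → (∀ a → c ≡ a) → Fin 1 ↔ A
Fin1↔-contractible c contract =
  mk↔ₛ′ (λ _ → c) (λ _ → Fin.zero) contract λ { Fin.zero → refl ; (Fin.suc ()) }

Fin0↔-empty : ∀ {A : Set} → ¬ A → Fin 0 ↔ A
Fin0↔-empty ¬a = mk↔ₛ′ (λ ()) (λ a → ⊥-elim (¬a a)) (λ a → ⊥-elim (¬a a)) (λ ())

Fin-+↔⊎ : ∀ {a b} {A B : Set} → Fin a ↔ A → Fin b ↔ B → Fin (a N.+ b) ↔ (A ⊎ B)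
Fin-+↔⊎ f g = ↔-trans +↔⊎ (f ⊎-↔ g)

a+b≡c⇒b≡-a+c : ∀ a {b c} → a + b ≡ c → b ≡ - a + c
a+b≡c⇒b≡-a+c a {b} {c} = y≈x\\z a b c

b≡-a+c⇒a+b≡c : ∀ a {b c} → b ≡ - a + c → a + b ≡ c
b≡-a+c⇒a+b≡c a {c = c} refl = \\-leftDividesˡ a c

WalkTo : ℤ × ℤ → Set
WalkTo t = Σ Path λ p → VerticallyConstrained p × endpoint p ≡ t

Walk : ℕ → ℤ → Set
Walk n m = WalkTo (+ n , m)

-- ⊥ is a proof-irrelevant record, so any two functions into it are definitionally equal.
VerticallyConstrained-irrelevant : ∀ p → Irrelevant (VerticallyConstrained p)
VerticallyConstrained-irrelevant []          _       _       = refl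
VerticallyConstrained-irrelevant (_ ∷ [])     _       _       = refl
VerticallyConstrained-irrelevant (_ ∷ t ∷ p) (h , v) (_ , w) =
  cong (h ,_) (VerticallyConstrained-irrelevant (t ∷ p) v w)

WalkTo-≡ : ∀ {t} {w w′ : WalkTo t} → proj₁ w ≡ proj₁ w′ → w ≡ w′
WalkTo-≡ {w = p , v , e} {.p , v′ , e′} refl =
  cong₂ (λ v e → p , v , e) (VerticallyConstrained-irrelevant p v v′) (uip e e′)

HeadNotVertical : Path → Set
HeadNotVertical []      = ⊤
HeadNotVertical (t ∷ _) = ¬ isVertical t

VerticallyConstrained-∷ : ∀ s {q} → (isVertical s → HeadNotVertical q) →
                          VerticallyConstrained q → VerticallyConstrained (s ∷ q)
VerticallyConstrained-∷ s {[]}    _ _ = tt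
VerticallyConstrained-∷ s {_ ∷ _} h v = h , v

VerticallyConstrained-∷⁻¹ : ∀ s q → VerticallyConstrained (s ∷ q) →
                            (isVertical s → HeadNotVertical q) × VerticallyConstrained q
VerticallyConstrained-∷⁻¹ s []      _ = (λ _ → tt) , tt
VerticallyConstrained-∷⁻¹ s (_ ∷ _) v = v

-- A step's vector is subtracted on the left (- a + k, not k - a): - 1ℤ + + suc n and - 0ℤ + + suc n
-- compute to + n and + suc n, so removing a step lands in the expected Walk type definitionally.
endpoint-∷ : ∀ s {q x y} → endpoint q ≡ (- proj₁ (vector s) + x , - proj₂ (vector s) + y) →
             endpoint (s ∷ q) ≡ (x , y)
endpoint-∷ s e = cong₂ _,_ (b≡-a+c⇒a+b≡c (proj₁ (vector s)) (cong proj₁ e))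
                           (b≡-a+c⇒a+b≡c (proj₂ (vector s)) (cong proj₂ e))

endpoint-∷⁻¹ : ∀ s {q x y} → endpoint (s ∷ q) ≡ (x , y) →
               endpoint q ≡ (- proj₁ (vector s) + x , - proj₂ (vector s) + y)
endpoint-∷⁻¹ s e = cong₂ _,_ (a+b≡c⇒b≡-a+c (proj₁ (vector s)) (cong proj₁ e))
                             (a+b≡c⇒b≡-a+c (proj₂ (vector s)) (cong proj₂ e))

prepend : ∀ s {x y} (w : WalkTo (- proj₁ (vector s) + x , - proj₂ (vector s) + y)) →
          (isVertical s → HeadNotVertical (proj₁ w)) → WalkTo (x , y)
prepend s (q , v , e) h = s ∷ q , VerticallyConstrained-∷ s h v , endpoint-∷ s e

behead : ∀ s {q x y} → VerticallyConstrained (s ∷ q) → endpoint (s ∷ q) ≡ (x , y) →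
         WalkTo (- proj₁ (vector s) + x , - proj₂ (vector s) + y)
behead s {q} v e = q , proj₂ (VerticallyConstrained-∷⁻¹ s q v) , endpoint-∷⁻¹ s e

diagonalSteps : Path → ℕ
diagonalSteps []       = 0
diagonalSteps (NE ∷ p) = suc (diagonalSteps p)
diagonalSteps (SE ∷ p) = suc (diagonalSteps p)
diagonalSteps (N ∷ p)  = diagonalSteps p
diagonalSteps (S ∷ p)  = diagonalSteps p

endpoint-width : ∀ p → proj₁ (endpoint p) ≡ + diagonalSteps p
endpoint-width []       = refl
endpoint-width (NE ∷ p) = cong (_+_ 1ℤ) (endpoint-width p)
endpoint-width (SE ∷ p) = cong (_+_ 1ℤ) (endpoint-width p)
endpoint-width (N ∷ p)  = cong (_+_ 0ℤ) (endpoint-width p)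
endpoint-width (S ∷ p)  = cong (_+_ 0ℤ) (endpoint-width p)

data WidthZero : Path → ℤ → Set where
  []  : WidthZero [] 0ℤ
  [N] : WidthZero (N ∷ []) 1ℤ
  [S] : WidthZero (S ∷ []) -[1+ 0 ]

widthZero : ∀ {m} p → VerticallyConstrained p → diagonalSteps p ≡ 0 →
            endpoint p ≡ (+ 0 , m) → WidthZero p m
widthZero []            _       _  refl = []
widthZero (N ∷ [])      _       _  refl = [N]
widthZero (S ∷ [])      _       _  refl = [S]
widthZero (NE ∷ _)      _       ()  _
widthZero (SE ∷ _)      _       ()  _
widthZero (N ∷ NE ∷ _)  _       ()  _
widthZero (N ∷ SE ∷ _)  _       ()  _
widthZero (S ∷ NE ∷ _)  _       ()  _
widthZero (S ∷ SE ∷ _)  _       ()  _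
widthZero (N ∷ N ∷ _)   (h , _) _  _ = ⊥-elim (h tt tt)
widthZero (N ∷ S ∷ _)   (h , _) _  _ = ⊥-elim (h tt tt)
widthZero (S ∷ N ∷ _)   (h , _) _  _ = ⊥-elim (h tt tt)
widthZero (S ∷ S ∷ _)   (h , _) _  _ = ⊥-elim (h tt tt)

Walk-widthZero : ∀ {m} (w : Walk 0 m) → WidthZero (proj₁ w) m
Walk-widthZero (p , v , e) =
  widthZero p v (+-injective (trans (sym (endpoint-width p)) (cong proj₁ e))) e

base : ℤ → ℕ
base (+ 0)           = 1
base (+ 1)           = 1
base (+ suc (suc _)) = 0
base -[1+ 0 ]        = 1
base -[1+ suc _ ]    = 0

base-↔ : ∀ m → Fin (base m) ↔ Walk 0 m
base-↔ (+ 0) = Fin1↔-contractible ([] , tt , refl) unique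
  where
  unique : ∀ w → ([] , tt , refl) ≡ w
  unique w with Walk-widthZero w
  ... | [] = WalkTo-≡ refl
base-↔ (+ 1) = Fin1↔-contractible (N ∷ [] , tt , refl) unique
  where
  unique : ∀ w → (N ∷ [] , tt , refl) ≡ w
  unique w with Walk-widthZero w
  ... | [N] = WalkTo-≡ refl
base-↔ (+ suc (suc k)) = Fin0↔-empty none
  where
  none : ¬ Walk 0 (+ suc (suc k))
  none w with Walk-widthZero w
  ... | ()
base-↔ -[1+ 0 ] = Fin1↔-contractible (S ∷ [] , tt , refl) unique
  where
  unique : ∀ w → (S ∷ [] , tt , refl) ≡ w
  unique w with Walk-widthZero w
  ... | [S] = WalkTo-≡ refl
base-↔ -[1+ suc k ] = Fin0↔-empty none
  where
  none : ¬ Walk 0 -[1+ suc k ]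
  none w with Walk-widthZero w
  ... | ()

DiagonalFirst : ℕ → ℤ → Set
DiagonalFirst n k = Walk n (- 1ℤ + k) ⊎ Walk n (1ℤ + k)

prependDiagonal : ∀ {n k} → DiagonalFirst n k → Walk (suc n) k
prependDiagonal (inj₁ w) = prepend NE w λ ()
prependDiagonal (inj₂ w) = prepend SE w λ ()

prependDiagonal-head : ∀ {n k} d → HeadNotVertical (proj₁ (prependDiagonal {n} {k} d))
prependDiagonal-head (inj₁ _) ()
prependDiagonal-head (inj₂ _) ()

splitDiagonal : ∀ {n k} (w : Walk (suc n) k) → HeadNotVertical (proj₁ w) → DiagonalFirst n k
splitDiagonal (NE ∷ _ , v , e) _ = inj₁ (behead NE v e)
splitDiagonal (SE ∷ _ , v , e) _ = inj₂ (behead SE v e)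
splitDiagonal (N ∷ _ , _ , _)  h = ⊥-elim (h tt)
splitDiagonal (S ∷ _ , _ , _)  h = ⊥-elim (h tt)

prependDiagonal-splitDiagonal : ∀ {n k} w h → prependDiagonal (splitDiagonal {n} {k} w h) ≡ w
prependDiagonal-splitDiagonal (NE ∷ _ , _ , _) _ = WalkTo-≡ refl
prependDiagonal-splitDiagonal (SE ∷ _ , _ , _) _ = WalkTo-≡ refl
prependDiagonal-splitDiagonal (N ∷ _ , _ , _)  h = ⊥-elim (h tt)
prependDiagonal-splitDiagonal (S ∷ _ , _ , _)  h = ⊥-elim (h tt)

Walk-suc-↔ : ∀ n m →
             (DiagonalFirst n m ⊎ (DiagonalFirst n (- 1ℤ + m) ⊎ DiagonalFirst n (1ℤ + m))) ↔ Walk (suc n) m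
Walk-suc-↔ n m = mk↔ₛ′ to from to-from from-to
  where
  to : DiagonalFirst n m ⊎ (DiagonalFirst n (- 1ℤ + m) ⊎ DiagonalFirst n (1ℤ + m)) → Walk (suc n) m
  to (inj₁ d)        = prependDiagonal d
  to (inj₂ (inj₁ d)) = prepend N (prependDiagonal d) λ _ → prependDiagonal-head {k = - 1ℤ + m} d
  to (inj₂ (inj₂ d)) = prepend S (prependDiagonal d) λ _ → prependDiagonal-head {k = 1ℤ + m} d

  from : Walk (suc n) m → DiagonalFirst n m ⊎ (DiagonalFirst n (- 1ℤ + m) ⊎ DiagonalFirst n (1ℤ + m))
  from ([] , _ , ())
  from w@(NE ∷ _ , _ , _) = inj₁ (splitDiagonal w λ ())
  from w@(SE ∷ _ , _ , _) = inj₁ (splitDiagonal w λ ())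
  from (N ∷ q , v , e)    =
    inj₂ (inj₁ (splitDiagonal (behead N v e) (proj₁ (VerticallyConstrained-∷⁻¹ N q v) tt)))
  from (S ∷ q , v , e)    =
    inj₂ (inj₂ (splitDiagonal (behead S v e) (proj₁ (VerticallyConstrained-∷⁻¹ S q v) tt)))

  to-from : ∀ w → to (from w) ≡ w
  to-from ([] , _ , ())
  to-from w@(NE ∷ _ , _ , _) = prependDiagonal-splitDiagonal w λ ()
  to-from w@(SE ∷ _ , _ , _) = prependDiagonal-splitDiagonal w λ ()
  to-from (N ∷ _ , _ , _) = WalkTo-≡ (cong (N ∷_) (cong proj₁ (prependDiagonal-splitDiagonal _ _)))
  to-from (S ∷ _ , _ , _) = WalkTo-≡ (cong (S ∷_) (cong proj₁ (prependDiagonal-splitDiagonal _ _)))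

  from-to : ∀ d → from (to d) ≡ d
  from-to (inj₁ (inj₁ _))        = cong (inj₁ ∘ inj₁) (WalkTo-≡ refl)
  from-to (inj₁ (inj₂ _))        = cong (inj₁ ∘ inj₂) (WalkTo-≡ refl)
  from-to (inj₂ (inj₁ (inj₁ _))) = cong (inj₂ ∘ inj₁ ∘ inj₁) (WalkTo-≡ refl)
  from-to (inj₂ (inj₁ (inj₂ _))) = cong (inj₂ ∘ inj₁ ∘ inj₂) (WalkTo-≡ refl)
  from-to (inj₂ (inj₂ (inj₁ _))) = cong (inj₂ ∘ inj₂ ∘ inj₁) (WalkTo-≡ refl)
  from-to (inj₂ (inj₂ (inj₂ _))) = cong (inj₂ ∘ inj₂ ∘ inj₂) (WalkTo-≡ refl)

walks : ℕ → ℤ → ℕ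
walks zero    m = base m
walks (suc n) m = diagonalFirst m N.+ (diagonalFirst (- 1ℤ + m) N.+ diagonalFirst (1ℤ + m))
  where
  diagonalFirst : ℤ → ℕ
  diagonalFirst k = walks n (- 1ℤ + k) N.+ walks n (1ℤ + k)

walks-↔ : ∀ n m → Fin (walks n m) ↔ Walk n m
walks-↔ zero    m = base-↔ m
walks-↔ (suc n) m =
  ↔-trans (Fin-+↔⊎ (diagonalFirst-↔ m) (Fin-+↔⊎ (diagonalFirst-↔ (- 1ℤ + m)) (diagonalFirst-↔ (1ℤ + m))))
          (Walk-suc-↔ n m)
  where
  diagonalFirst-↔ : ∀ k → Fin (walks n (- 1ℤ + k) N.+ walks n (1ℤ + k)) ↔ DiagonalFirst n k
  diagonalFirst-↔ k = Fin-+↔⊎ (walks-↔ n (- 1ℤ + k)) (walks-↔ n (1ℤ + k))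

walks-suc : ∀ n m → walks (suc n) m ≡ walks n (m + + 2) N.+ walks n (m + 1ℤ) N.+ 2 * walks n m
                                       N.+ walks n (m - 1ℤ) N.+ walks n (m - + 2)
walks-suc n m = begin
  walks (suc n) m
    ≡⟨ cong₂ N._+_ (cong₂ N._+_ (cong W (+-comm (- 1ℤ) m)) (cong W (+-comm 1ℤ m)))
                   (cong₂ N._+_ (cong₂ N._+_ (cong W (twice (- 1ℤ))) (cong W (\\-leftDividesˡ 1ℤ m)))
                                (cong₂ N._+_ (cong W (\\-leftDividesʳ 1ℤ m)) (cong W (twice 1ℤ)))) ⟩
  (W (m - 1ℤ) N.+ W (m + 1ℤ)) N.+ ((W (m - + 2) N.+ W m) N.+ (W m N.+ W (m + + 2)))
    ≡⟨ regroup (W (m + + 2)) (W (m + 1ℤ)) (W m) (W (m - 1ℤ)) (W (m - + 2)) ⟩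
  W (m + + 2) N.+ W (m + 1ℤ) N.+ 2 * W m N.+ W (m - 1ℤ) N.+ W (m - + 2) ∎
  where
  open ≡-Reasoning
  W : ℤ → ℕ
  W = walks n
  twice : ∀ a → a + (a + m) ≡ m + (a + a)
  twice a = trans (sym (+-assoc a a m)) (+-comm (a + a) m)
  regroup : ∀ a b c d e → (d N.+ b) N.+ ((e N.+ c) N.+ (c N.+ a)) ≡ a N.+ b N.+ 2 * c N.+ d N.+ e
  regroup = solve-∀

lemma11 : Σ (ℕ → ℤ → ℕ) λ BH →
      ((n : ℕ) (m : ℤ) →
        Fin (BH n m) ↔ Σ Path λ p → VerticallyConstrained p × endpoint p ≡ (+ n , m))
    × (BH 0 (+ 0) ≡ 1) × (BH 0 (+ 1) ≡ 1) × (BH 0 -[1+ 0 ] ≡ 1)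
    × ((k : ℕ) → BH 0 (+ suc (suc k)) ≡ 0)
    × ((k : ℕ) → BH 0 -[1+ suc k ] ≡ 0)
    × ((n : ℕ) (m : ℤ) →
        BH (suc n) m ≡ BH n (m + + 2) N.+ BH n (m + 1ℤ) N.+ 2 * BH n m
                         N.+ BH n (m - 1ℤ) N.+ BH n (m - + 2))
lemma11 = walks , walks-↔ , refl , refl , refl , (λ _ → refl) , (λ _ → refl) , walks-suc
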